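{- Let $k\ge2$ and $0\le r\le k-2$ be integers, and let $B$ be the truncated augmented Heaviside sequence of mass $T_k+r$: $B_i=0$ for $i>T_{k-1}+1+r$, and for $1\le i\le T_{k-1}+1+r$, $B_i=2$ if $i=T_p+1$ for some $p\in\{1,\dots,k-1\}$ and $B_i=1$ otherwise. Then $\Phi^{T_{k-1}}(B)$ is a $(k-r-2)$-biaugmented marching group of the second kind with parameter $k$.
   Context: $T_j=j(j+1)/2$. Move $\Phi$ on mancala configurations $\lambda:\mathbb N^*\to\mathbb N$ (support $\{1,\dots,\ell\}$): $\mu=\Phi(\lambda)$, $\mu_i=\lambda_{i+1}+1$ for $1\le i\le\lambda_1$, $\mu_i=\lambda_{i+1}$ for $i>\lambda_1$; $\Phi^t$ its iterate. Marching group $M^j_i=j-i+1$ for $i\le j$, $0$ otherwise. For $k\ge2$ and $0\le q\le k-2$, a $q$-biaugmented marching group of the second kind with parameter $k$ is a configuration $M^{k-1}+\epsilon$ with $\epsilon_i\in\{1,2\}$ for $1\le i<k-q-1$, $\epsilon_{k-q-1}=2$, $\epsilon_i=1$ for $k-q\le i<k$, and $\epsilon_i=0$ for $i\ge k$. -}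

module Defs where

open import Data.Nat using (ℕ; zero; suc; _+_; _*_; _∸_; _≤_; _<_; _≤?_; _≟_)
open import Data.Product using (Σ; ∃; _×_; _,_)
open import Data.Sum using (_⊎_)
open import Relation.Binary.PropositionalEquality using (_≡_)
open import Relation.Nullary using (yes; no)
open import Relation.Nullary.Decidable using (⌊_⌋)
open import Data.Bool using (Bool; true; false; if_then_else_; _∨_)

T : ℕ → ℕ
T zero = 0
T (suc j) = T j + suc j

-- A mancala configuration is a function ℕ → ℕ; only indices i ≥ 1 are meaningful
-- (index 0 is ignored everywhere; Φ sets it to 0).
Config : Set
Config = ℕ → ℕ

Φ : Config → Config
Φ l zero = 0
Φ l (suc i) = if ⌊ suc i ≤? l 1 ⌋ then suc (l (suc (suc i))) else l (suc (suc i))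

Φ^ : ℕ → Config → Config
Φ^ zero l = l
Φ^ (suc t) l = Φ (Φ^ t l)

M : ℕ → Config
M j i = if ⌊ i ≤? j ⌋ then suc j ∸ i else 0

-- q-biaugmented marching group of the second kind with parameter k
-- (k ≥ 2 and q ≤ k - 2 are assumed by the caller): configuration equal
-- (at all indices i ≥ 1) to M^{k-1} + ε with ε as specified.
IsBiaugmented2 : ℕ → ℕ → Config → Set
IsBiaugmented2 k q c =
  Σ Config λ ε →
    ((i : ℕ) → 1 ≤ i → i < k ∸ q ∸ 1 → (ε i ≡ 1 ⊎ ε i ≡ 2)) ×
    (ε (k ∸ q ∸ 1) ≡ 2) ×
    ((i : ℕ) → k ∸ q ≤ i → i < k → ε i ≡ 1) ×
    ((i : ℕ) → k ≤ i → ε i ≡ 0) ×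
    ((i : ℕ) → 1 ≤ i → c i ≡ M (k ∸ 1) i + ε i)

isTriPlus1 : ℕ → ℕ → Bool
isTriPlus1 zero i = false
isTriPlus1 (suc p) i = ⌊ i ≟ suc (T (suc p)) ⌋ ∨ isTriPlus1 p i

Heaviside : ℕ → ℕ → Config
Heaviside k r zero = 0
Heaviside k r (suc i) =
  if ⌊ suc i ≤? T (k ∸ 1) + 1 + r ⌋
  then (if isTriPlus1 (k ∸ 1) (suc i) then 2 else 1)
  else 0

-- Write Φ^t(B)_i = B_{i+t} + x_t(i-1), where the excess x_t is a finite list: a move drops the head of
-- x_t and adds 1 to its first c entries, c being the current first pile.  Between times T_p and
-- T_{p+1} the first pile receives the 2 at position T_p + 1 and then the 1s at T_p + 2, …, T_{p+1},
-- and each of these moves turns one explicit shape of the excess into the next.  At time T_{k-1}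
-- the excess is (k-1, k-1, k-2, …, 2), which is M^{k-1} plus 1 on positions 2, …, k-1, while the
-- remaining tail of B is a 2 followed by r ones.
module Submission where

open import Defs
open import Data.Nat using (ℕ; zero; suc; _+_; _∸_; _≤_; _<_; _≤?_; _≟_; z≤n; s≤s)
open import Data.Nat.Properties
open import Data.List using (List; []; _∷_; _++_; map; length; replicate)
open import Data.List.Properties using (map-++; length-++; ++-assoc; ++-identityʳ)
open import Data.Bool using (true; false; if_then_else_)
open import Data.Product using (_,_)
open import Data.Sum using (inj₂)
open import Function using (_∘_)
open import Relation.Binary.PropositionalEquality
open import Relation.Nullary using (Dec; yes; no; ¬_; contradiction)
open import Relation.Nullary.Decidable using (⌊_⌋)

if-yes : ∀ {P A : Set} (p? : Dec P) {x y : A} → P → (if ⌊ p? ⌋ then x else y) ≡ x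
if-yes (yes _) _ = refl
if-yes (no ¬p) p = contradiction p ¬p

if-no : ∀ {P A : Set} (p? : Dec P) {x y : A} → ¬ P → (if ⌊ p? ⌋ then x else y) ≡ y
if-no (yes p) ¬p = contradiction p ¬p
if-no (no _) _ = refl

M-≤ : ∀ {i j} → i ≤ j → M j i ≡ suc j ∸ i
M-≤ {i} {j} = if-yes (i ≤? j)

M-> : ∀ {i j} → j < i → M j i ≡ 0
M-> {i} {j} = if-no (i ≤? j) ∘ <⇒≱

-- nth reads a list as a function ℕ → ℕ that vanishes beyond its length.
nth : List ℕ → ℕ → ℕ
nth [] n = 0
nth (x ∷ xs) zero = x
nth (x ∷ xs) (suc n) = nth xs n

incrementPrefix : ℕ → List ℕ → List ℕ
incrementPrefix zero xs = xs
incrementPrefix (suc c) [] = 1 ∷ incrementPrefix c []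
incrementPrefix (suc c) (x ∷ xs) = suc x ∷ incrementPrefix c xs

nth-incrementPrefix-< : ∀ {c n} xs → n < c → nth (incrementPrefix c xs) n ≡ suc (nth xs n)
nth-incrementPrefix-< {suc c} {zero} [] _ = refl
nth-incrementPrefix-< {suc c} {zero} (x ∷ xs) _ = refl
nth-incrementPrefix-< {suc c} {suc n} [] (s≤s n<c) = nth-incrementPrefix-< [] n<c
nth-incrementPrefix-< {suc c} {suc n} (x ∷ xs) (s≤s n<c) = nth-incrementPrefix-< xs n<c

nth-incrementPrefix-≥ : ∀ {c n} xs → c ≤ n → nth (incrementPrefix c xs) n ≡ nth xs n
nth-incrementPrefix-≥ {zero} xs _ = refl
nth-incrementPrefix-≥ {suc c} {suc n} [] (s≤s c≤n) = nth-incrementPrefix-≥ [] c≤n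
nth-incrementPrefix-≥ {suc c} {suc n} (x ∷ xs) (s≤s c≤n) = nth-incrementPrefix-≥ xs c≤n

incrementPrefix-length+ : ∀ xs e → incrementPrefix (length xs + e) xs ≡ map suc xs ++ replicate e 1
incrementPrefix-length+ [] zero = refl
incrementPrefix-length+ [] (suc e) = cong (1 ∷_) (incrementPrefix-length+ [] e)
incrementPrefix-length+ (x ∷ xs) e = cong (suc x ∷_) (incrementPrefix-length+ xs e)

descending : ℕ → ℕ → List ℕ
descending zero b = []
descending (suc n) b = suc (n + b) ∷ descending n b

length-descending : ∀ n b → length (descending n b) ≡ n
length-descending zero b = refl
length-descending (suc n) b = cong suc (length-descending n b)

map-suc-descending : ∀ n b → map suc (descending n b) ≡ descending n (suc b)
map-suc-descending zero b = refl
map-suc-descending (suc n) b = cong₂ _∷_ (cong suc (sym (+-suc n b))) (map-suc-descending n b)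

descending-suc : ∀ n b → descending (suc n) b ≡ map suc (descending n b) ++ suc b ∷ []
descending-suc zero b = refl
descending-suc (suc n) b = cong (suc (suc (n + b)) ∷_) (descending-suc n b)

nth-descending-< : ∀ {d n} b → n < d → nth (descending d b) n ≡ (d ∸ n) + b
nth-descending-< {suc d} {zero} b _ = refl
nth-descending-< {suc d} {suc n} b (s≤s n<d) = nth-descending-< b n<d

nth-descending-≥ : ∀ {d n} b → d ≤ n → nth (descending d b) n ≡ 0
nth-descending-≥ {zero} b _ = refl
nth-descending-≥ {suc d} {suc n} b (s≤s d≤n) = nth-descending-≥ b d≤n

Φ-excess : ∀ (l s : Config) x xs → (∀ n → l (suc n) ≡ s (suc n) + nth (x ∷ xs) n) →
           ∀ n → Φ l (suc n) ≡ s (suc (suc n)) + nth (incrementPrefix (l 1) xs) n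
Φ-excess l s x xs l≡s+x∷xs n with suc n ≤? l 1
... | yes n<c = begin
  suc (l (suc (suc n)))                           ≡⟨ cong suc (l≡s+x∷xs (suc n)) ⟩
  suc (s (suc (suc n)) + nth xs n)                ≡⟨ +-suc _ _ ⟨
  s (suc (suc n)) + suc (nth xs n)                ≡⟨ cong (s (suc (suc n)) +_) (nth-incrementPrefix-< xs n<c) ⟨
  s (suc (suc n)) + nth (incrementPrefix (l 1) xs) n ∎
  where open ≡-Reasoning
... | no n≮c = trans (l≡s+x∷xs (suc n))
                     (cong (s (suc (suc n)) +_) (sym (nth-incrementPrefix-≥ xs (≮⇒≥ n≮c))))

T-mono : ∀ {p q} → p ≤ q → T p ≤ T q
T-mono {zero} _ = z≤n
T-mono {suc p} {suc q} (s≤s p≤q) = +-mono-≤ (T-mono p≤q) (s≤s p≤q)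

T-gap-≢ : ∀ {p x} q → T p < x → x < T (suc p) → x ≢ T q
T-gap-≢ {p} q Tp<x x<Tp+1 refl with q ≤? p
... | yes q≤p = <⇒≱ Tp<x (T-mono q≤p)
... | no q≰p = <⇒≱ x<Tp+1 (T-mono (≰⇒> q≰p))

isTriPlus1-true : ∀ {n} q → q < n → isTriPlus1 n (suc (T (suc q))) ≡ true
isTriPlus1-true {suc n} q (s≤s q≤n) with suc (T (suc q)) ≟ suc (T (suc n)) | q ≟ n
... | yes _ | _ = refl
... | no Tq≢Tn | yes refl = contradiction refl Tq≢Tn
... | no _ | no q≢n = isTriPlus1-true q (≤∧≢⇒< q≤n q≢n)

isTriPlus1-false : ∀ n {x} → (∀ q → x ≢ T (suc q)) → isTriPlus1 n (suc x) ≡ false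
isTriPlus1-false zero _ = refl
isTriPlus1-false (suc n) {x} x≢T with suc x ≟ suc (T (suc n))
... | yes x≡T = contradiction (suc-injective x≡T) (x≢T n)
... | no _ = isTriPlus1-false n x≢T

Heaviside-support : ∀ n r → T n + 1 + r ≡ suc (r + T n)
Heaviside-support n r = trans (cong (_+ r) (+-comm (T n) 1)) (cong suc (+-comm (T n) r))

Heaviside-within : ∀ {n r x} → x ≤ r + T n → Heaviside (suc n) r (suc x) ≡ (if isTriPlus1 n (suc x) then 2 else 1)
Heaviside-within {n} {r} {x} x≤ = if-yes (suc x ≤? T n + 1 + r) (subst (suc x ≤_) (sym (Heaviside-support n r)) (s≤s x≤))

Heaviside-beyond : ∀ {n r x} → r + T n < x → Heaviside (suc n) r (suc x) ≡ 0
Heaviside-beyond {n} {r} {x} x> =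
  if-no (suc x ≤? T n + 1 + r) (<⇒≱ x> ∘ ≤-pred ∘ subst (suc x ≤_) (Heaviside-support n r))

Heaviside-first : ∀ {n r} → Heaviside (suc n) r 1 ≡ 1
Heaviside-first {n} {r} = trans (Heaviside-within {n} {r} z≤n)
  (cong (λ b → if b then 2 else 1) (isTriPlus1-false n λ q 0≡T → 0≢1+n (trans 0≡T (+-suc (T q) q))))

Heaviside-triangle : ∀ {n r q} → q < n → Heaviside (suc n) r (suc (T (suc q))) ≡ 2
Heaviside-triangle {n} {r} {q} q<n = trans (Heaviside-within {n} {r} (≤-trans (T-mono q<n) (m≤n+m (T n) r)))
  (cong (λ b → if b then 2 else 1) (isTriPlus1-true q q<n))

Heaviside-between : ∀ {n r p j} → 1 ≤ j → j ≤ p → j + T p ≤ r + T n → Heaviside (suc n) r (suc (j + T p)) ≡ 1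
Heaviside-between {n} {r} {p} {j} 1≤j j≤p bound = trans (Heaviside-within {n} {r} bound)
  (cong (λ b → if b then 2 else 1) (isTriPlus1-false n λ q → T-gap-≢ (suc q) above below))
  where
  above : T p < j + T p
  above = +-monoˡ-≤ (T p) 1≤j
  below : j + T p < T (suc p)
  below = ≤-trans (+-monoˡ-≤ (T p) (s≤s j≤p)) (≤-reflexive (+-comm (suc p) (T p)))

biaugmentation : ℕ → ℕ → Config
biaugmentation k r i = if ⌊ i ≤? suc r ⌋ then 2 else if ⌊ i <? k ⌋ then 1 else 0

biaugmentation-≤ : ∀ {k r i} → i ≤ suc r → biaugmentation k r i ≡ 2
biaugmentation-≤ {k} {r} {i} = if-yes (i ≤? suc r)

biaugmentation-between : ∀ {k r i} → suc r < i → i < k → biaugmentation k r i ≡ 1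
biaugmentation-between {k} {r} {i} r+1<i i<k =
  trans (if-no (i ≤? suc r) (<⇒≱ r+1<i)) (if-yes (i <? k) i<k)

biaugmentation-≥ : ∀ {k r i} → suc r < i → k ≤ i → biaugmentation k r i ≡ 0
biaugmentation-≥ {k} {r} {i} r+1<i k≤i =
  trans (if-no (i ≤? suc r) (<⇒≱ r+1<i)) (if-no (i <? k) (≤⇒≯ k≤i))

m∸[m∸n∸2]≡2+n : ∀ {m n} → suc (suc n) ≤ m → m ∸ (m ∸ n ∸ 2) ≡ suc (suc n)
m∸[m∸n∸2]≡2+n {m} {n} n+2≤m =
  trans (cong (m ∸_) (trans (∸-+-assoc m n 2) (cong (m ∸_) (+-comm n 2)))) (m∸[m∸n]≡n n+2≤m)

-- phase d j is the excess at time j + T q of the round that ends at T (suc q), where q = d + j.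
phase : ℕ → ℕ → List ℕ
phase d j = descending d (suc j) ++ j ∷ j ∷ descending j 0

length-phase : ∀ d j → length (phase d j) ≡ d + suc (suc j)
length-phase d j = trans (length-++ (descending d (suc j)))
  (cong₂ _+_ (length-descending d (suc j)) (cong (suc ∘ suc) (length-descending j 0)))

phase-shift : ∀ d j → map suc (phase d j) ++ 1 ∷ [] ≡ phase d (suc j)
phase-shift d j = begin
  map suc (phase d j) ++ 1 ∷ []
    ≡⟨ cong (_++ 1 ∷ []) (map-++ suc (descending d (suc j)) (j ∷ j ∷ descending j 0)) ⟩
  (map suc (descending d (suc j)) ++ suc j ∷ suc j ∷ map suc (descending j 0)) ++ 1 ∷ []
    ≡⟨ ++-assoc (map suc (descending d (suc j))) _ (1 ∷ []) ⟩
  map suc (descending d (suc j)) ++ suc j ∷ suc j ∷ (map suc (descending j 0) ++ 1 ∷ [])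
    ≡⟨ cong₂ (λ xs ys → xs ++ suc j ∷ suc j ∷ ys) (map-suc-descending d (suc j)) (sym (descending-suc j 0)) ⟩
  phase d (suc j) ∎
  where open ≡-Reasoning

-- stairs p = (p+1, p+1, p, …, 2) is the excess at time T (suc p).
stairs : ℕ → List ℕ
stairs p = suc p ∷ descending p 1

module HeavisideOrbit (m r : ℕ) where

  B : Config
  B = Heaviside (suc (suc m)) r

  Excess : ℕ → List ℕ → Set
  Excess t xs = ∀ n → Φ^ t B (suc n) ≡ B (suc n + t) + nth xs n

  excess-initial : Excess 0 (0 ∷ [])
  excess-initial zero = sym (+-identityʳ (B 1))
  excess-initial (suc n) = sym (trans (+-identityʳ _) (cong (B ∘ suc ∘ suc) (+-identityʳ n)))

  excess-move : ∀ {t t′ x xs e ys} → Excess t (x ∷ xs) → B (suc t) + x ≡ length xs + e →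
                suc t ≡ t′ → map suc xs ++ replicate e 1 ≡ ys → Excess t′ ys
  excess-move {t} {x = x} {xs} {e} excess pile refl refl n = begin
    Φ (Φ^ t B) (suc n)
      ≡⟨ Φ-excess (Φ^ t B) (λ i → B (i + t)) x xs excess n ⟩
    B (suc (suc n) + t) + nth (incrementPrefix (Φ^ t B 1) xs) n
      ≡⟨ cong₂ (λ i c → B (suc i) + nth (incrementPrefix c xs) n) (sym (+-suc n t)) (trans (excess 0) pile) ⟩
    B (suc n + suc t) + nth (incrementPrefix (length xs + e) xs) n
      ≡⟨ cong (λ ys → B (suc n + suc t) + nth ys n) (incrementPrefix-length+ xs e) ⟩
    B (suc n + suc t) + nth (map suc xs ++ replicate e 1) n ∎
    where open ≡-Reasoning

  within-round : ∀ {j q} → j ≤ q → q ≤ m → j + T q ≤ r + T (suc m)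
  within-round {j} {q} j≤q q≤m = begin
    j + T q       ≤⟨ +-monoˡ-≤ (T q) (m≤n⇒m≤1+n j≤q) ⟩
    suc q + T q   ≡⟨ +-comm (suc q) (T q) ⟩
    T (suc q)     ≤⟨ T-mono (s≤s q≤m) ⟩
    T (suc m)     ≤⟨ m≤n+m (T (suc m)) r ⟩
    r + T (suc m) ∎
    where open ≤-Reasoning

  excess-walk : ∀ {q} d j → d + suc j ≡ q → q ≤ m →
                Excess (suc j + T q) (phase d (suc j)) → Excess (q + T q) (phase 0 q)
  excess-walk zero j refl _ excess = excess
  excess-walk {q} (suc d) j d+j+2≡q q≤m excess =
    excess-walk d (suc j) (trans (+-suc d (suc j)) d+j+2≡q) q≤m
      (excess-move excess pile refl (phase-shift d (suc j)))
    where
    j<q : suc j ≤ q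
    j<q = ≤-trans (m≤n+m (suc j) (suc d)) (≤-reflexive d+j+2≡q)
    pile : B (suc (suc j + T q)) + suc (d + suc (suc j)) ≡ length (phase d (suc j)) + 1
    pile = begin
      B (suc (suc j + T q)) + suc (d + suc (suc j))
        ≡⟨ cong (_+ suc (d + suc (suc j))) (Heaviside-between {suc m} {r} (s≤s z≤n) j<q (within-round j<q q≤m)) ⟩
      suc (suc (d + suc (suc j)))  ≡⟨ cong suc (+-suc d (suc (suc j))) ⟨
      suc (d + suc (suc (suc j)))  ≡⟨ +-comm 1 _ ⟩
      d + suc (suc (suc j)) + 1    ≡⟨ cong (_+ 1) (length-phase d (suc j)) ⟨
      length (phase d (suc j)) + 1 ∎
      where open ≡-Reasoning

  excess-round : ∀ {p} → suc p ≤ m → Excess (T (suc p)) (stairs p) → Excess (T (suc (suc p))) (stairs (suc p))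
  excess-round {p} p<m excess =
    excess-move walked endPile (+-comm (suc (suc p)) (T (suc p))) endList
    where
    startPile : B (suc (T (suc p))) + suc p ≡ length (descending p 1) + 3
    startPile = begin
      B (suc (T (suc p))) + suc p  ≡⟨ cong (_+ suc p) (Heaviside-triangle {suc m} {r} (m<n⇒m<1+n p<m)) ⟩
      3 + p                        ≡⟨ +-comm 3 p ⟩
      p + 3                        ≡⟨ cong (_+ 3) (length-descending p 1) ⟨
      length (descending p 1) + 3  ∎
      where open ≡-Reasoning
    walked : Excess (suc p + T (suc p)) (phase 0 (suc p))
    walked = excess-walk p 0 (+-comm p 1) p<m
      (excess-move excess startPile refl (cong (_++ 1 ∷ 1 ∷ 1 ∷ []) (map-suc-descending p 1)))
    endPile : B (suc (suc p + T (suc p))) + suc p ≡ length (suc p ∷ descending (suc p) 0) + 0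
    endPile = begin
      B (suc (suc p + T (suc p))) + suc p
        ≡⟨ cong (_+ suc p) (Heaviside-between {suc m} {r} {suc p} (s≤s z≤n) ≤-refl (within-round {suc p} ≤-refl p<m)) ⟩
      suc (suc p)                                ≡⟨ cong suc (length-descending (suc p) 0) ⟨
      suc (length (descending (suc p) 0))        ≡⟨ +-identityʳ _ ⟨
      length (suc p ∷ descending (suc p) 0) + 0  ∎
      where open ≡-Reasoning
    endList : map suc (suc p ∷ descending (suc p) 0) ++ [] ≡ stairs (suc p)
    endList = trans (++-identityʳ _) (cong (suc (suc p) ∷_) (map-suc-descending (suc p) 0))

  excess-stairs : ∀ p → p ≤ m → Excess (T (suc p)) (stairs p)
  excess-stairs zero _ = excess-move excess-initial (cong (_+ 0) (Heaviside-first {suc m} {r})) refl refl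
  excess-stairs (suc p) p<m = excess-round p<m (excess-stairs p (≤-trans (n≤1+n p) p<m))

  tail+stairs : r ≤ m → ∀ n →
    B (suc n + T (suc m)) + nth (stairs m) n ≡ M (suc m) (suc n) + biaugmentation (suc (suc m)) r (suc n)
  tail+stairs _ zero = begin
    B (suc (T (suc m))) + suc m  ≡⟨ cong (_+ suc m) (Heaviside-triangle {suc m} {r} ≤-refl) ⟩
    2 + suc m                    ≡⟨ +-comm 2 (suc m) ⟩
    suc m + 2                    ≡⟨ cong (suc m +_) (biaugmentation-≤ {suc (suc m)} {r} (s≤s z≤n)) ⟨
    M (suc m) 1 + biaugmentation (suc (suc m)) r 1 ∎
    where open ≡-Reasoning
  tail+stairs r≤m (suc n) with n <? r | n <? m
  ... | yes n<r | _ = begin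
    B (suc (suc n + T (suc m))) + nth (descending m 1) n
      ≡⟨ cong₂ _+_ (Heaviside-between {suc m} {r} (s≤s z≤n) (s≤s (<⇒≤ n<m)) (+-monoˡ-≤ (T (suc m)) n<r))
                   (nth-descending-< 1 n<m) ⟩
    suc (m ∸ n + 1)  ≡⟨ +-suc (m ∸ n) 1 ⟨
    m ∸ n + 2        ≡⟨ cong₂ _+_ (M-≤ (s≤s n<m)) (biaugmentation-≤ (s≤s n<r)) ⟨
    M (suc m) (suc (suc n)) + biaugmentation (suc (suc m)) r (suc (suc n)) ∎
    where
    open ≡-Reasoning
    n<m : n < m
    n<m = ≤-trans n<r r≤m
  ... | no n≮r | yes n<m = begin
    B (suc (suc n + T (suc m))) + nth (descending m 1) n
      ≡⟨ cong₂ _+_ (Heaviside-beyond {suc m} {r} (+-monoˡ-< (T (suc m)) (s≤s (≮⇒≥ n≮r))))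
                   (nth-descending-< 1 n<m) ⟩
    m ∸ n + 1
      ≡⟨ cong₂ _+_ (M-≤ (s≤s n<m)) (biaugmentation-between (s≤s (s≤s (≮⇒≥ n≮r))) (s≤s (s≤s n<m))) ⟨
    M (suc m) (suc (suc n)) + biaugmentation (suc (suc m)) r (suc (suc n)) ∎
    where open ≡-Reasoning
  ... | no n≮r | no n≮m = begin
    B (suc (suc n + T (suc m))) + nth (descending m 1) n
      ≡⟨ cong₂ _+_ (Heaviside-beyond {suc m} {r} (+-monoˡ-< (T (suc m)) (s≤s (≮⇒≥ n≮r))))
                   (nth-descending-≥ 1 (≮⇒≥ n≮m)) ⟩
    0
      ≡⟨ cong₂ _+_ (M-> (s≤s (s≤s (≮⇒≥ n≮m)))) (biaugmentation-≥ (s≤s (s≤s (≮⇒≥ n≮r))) (s≤s (s≤s (≮⇒≥ n≮m)))) ⟨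
    M (suc m) (suc (suc n)) + biaugmentation (suc (suc m)) r (suc (suc n)) ∎
    where open ≡-Reasoning

  final-configuration : r ≤ m → ∀ n →
    Φ^ (T (suc m)) B (suc n) ≡ M (suc m) (suc n) + biaugmentation (suc (suc m)) r (suc n)
  final-configuration r≤m n = trans (excess-stairs m ≤-refl n) (tail+stairs r≤m n)

mainTheorem10 : (k r : ℕ) → 2 ≤ k → r ≤ k ∸ 2 →
    IsBiaugmented2 k (k ∸ r ∸ 2) (Φ^ (T (k ∸ 1)) (Heaviside k r))
mainTheorem10 (suc (suc m)) r _ r≤m rewrite m∸[m∸n∸2]≡2+n {suc (suc m)} {r} (s≤s (s≤s r≤m)) =
  biaugmentation k r ,
  (λ _ _ i≤r → inj₂ (biaugmentation-≤ {k} {r} (<⇒≤ i≤r))) ,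
  biaugmentation-≤ {k} {r} ≤-refl ,
  (λ _ → biaugmentation-between {k} {r}) ,
  (λ _ k≤i → biaugmentation-≥ {k} {r} (≤-trans (s≤s (s≤s r≤m)) k≤i) k≤i) ,
  λ { (suc n) _ → final-configuration r≤m n }
  where
  open HeavisideOrbit m r
  k : ℕ
  k = suc (suc m)
mainTheorem10 (suc zero) r (s≤s ()) _
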